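{- Let $f:\mathbb{Z}^n\to\mathbb{Z}^{n'}$ be a linear function, i.e. $f(\vec{x})=A\vec{x}+\vec{v}$ for an integer $n'\times n$ matrix $A$ and $\vec{v}\in\mathbb{Z}^{n'}$. If $X\subseteq\mathbb{Z}^n$ is pseudo-linear then $f(X)$ is pseudo-linear; moreover, for every linearization $L$ of $X$, the set $f(L)$ is a linearization of $f(X)$.
   Context: A monoid of $\mathbb{Q}^n$ is a set $M$ with $\vec{0}\in M$ and $M+M\subseteq M$; $P^*$ is the monoid generated by $P$; $M$ is finitely generated if $M=P^*$ for some finite $P$. A vector $\vec{a}\in M$ is interior to $M$ if for every $\vec{x}\in M$ there is an integer $N\geq1$ with $N\vec{a}\in\vec{x}+M$. A set $X\subseteq\mathbb{Z}^n$ is pseudo-linear if there exist $\vec{b}\in\mathbb{Z}^n$ and a finitely generated monoid $M\subseteq\mathbb{Z}^n$ with $X\subseteq\vec{b}+M$ such that for every finite set $R$ of interior vectors of $M$ there exists $\vec{x}\in X$ with $\vec{x}+R^*\subseteq X$; such an $M$ is a linearizator of $X$ and $L=\vec{b}+M$ a linearization of $X$. -}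

module Defs where

open import Level using (0ℓ)
open import Data.Nat using (ℕ; suc; _≤_)
open import Data.Integer using (ℤ; +_; _+_; _*_)
open import Data.Vec using (Vec; zipWith; map; replicate; foldr)
open import Data.List using (List)
open import Data.List.Membership.Propositional using (_∈_)
open import Data.List.Relation.Unary.All using (All)
open import Data.Product using (Σ; ∃; ∃-syntax; _×_)
open import Relation.Unary using (Pred; _⊆_)
open import Relation.Binary.PropositionalEquality using (_≡_)

ℤ^ : ℕ → Set
ℤ^ n = Vec ℤ n

Subset : ℕ → Set₁
Subset n = Pred (ℤ^ n) 0ℓ

infixl 6 _⊕_
_⊕_ : ∀ {n} → ℤ^ n → ℤ^ n → ℤ^ n
_⊕_ = zipWith _+_

_•_ : ∀ {n} → ℕ → ℤ^ n → ℤ^ n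
N • x = map (λ a → (+ N) * a) x

𝟎 : ∀ {n} → ℤ^ n
𝟎 = replicate _ (+ 0)

_≐_ : ∀ {n} → Subset n → Subset n → Set
X ≐ Y = (X ⊆ Y) × (Y ⊆ X)

-- P* : the monoid generated by a finite set P (given as a list):
-- the least set containing 0 and closed under adding elements of P
data Gen {n} (P : List (ℤ^ n)) : Subset n where
  gen-zero : Gen P 𝟎
  gen-step : ∀ {x p} → Gen P x → p ∈ P → Gen P (x ⊕ p)

FinGen : ∀ {n} → Subset n → Set
FinGen {n} M = Σ (List (ℤ^ n)) λ P → M ≐ Gen P

Translate : ∀ {n} → ℤ^ n → Subset n → Subset n
Translate b M y = ∃[ m ] (M m × y ≡ b ⊕ m)

Interior : ∀ {n} → Subset n → ℤ^ n → Set
Interior M a = M a × (∀ x → M x → ∃[ N ] (1 ≤ N × Translate x M (N • a)))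

IsLinearizatorAt : ∀ {n} → Subset n → ℤ^ n → Subset n → Set
IsLinearizatorAt X b M =
  FinGen M × (X ⊆ Translate b M) ×
  (∀ (R : List _) → All (Interior M) R →
     ∃[ x ] (X x × (∀ y → Gen R y → X (x ⊕ y))))

PseudoLinear : ∀ {n} → Subset n → Set₁
PseudoLinear {n} X = Σ (ℤ^ n) λ b → Σ (Subset n) λ M → IsLinearizatorAt X b M

IsLinearization : ∀ {n} → Subset n → Subset n → Set₁
IsLinearization {n} X L =
  Σ (ℤ^ n) λ b → Σ (Subset n) λ M → IsLinearizatorAt X b M × (L ≐ Translate b M)

Matrix : ℕ → ℕ → Set
Matrix n' n = Vec (Vec ℤ n) n'

dot : ∀ {n} → ℤ^ n → ℤ^ n → ℤ
dot u w = foldr _ _+_ (+ 0) (zipWith _*_ u w)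

affine : ∀ {n n'} → Matrix n' n → ℤ^ n' → ℤ^ n → ℤ^ n'
affine A v x = map (λ row → dot row x) A ⊕ v

Image : ∀ {n n'} → (ℤ^ n → ℤ^ n') → Subset n → Subset n'
Image f X y = ∃[ x ] (X x × f x ≡ y)

module Submission where

-- Write g = lin A for the linear part of f. If M = P* is a linearizator of X
-- with base b, then M' = (g P)* = g(M) is a linearizator of f(X) with base
-- f b; as f(b + M) = f b + g(M), this also proves the statement about
-- linearizations. The only real work is pulling interior vectors of M' back
-- to interior vectors of M. Let a₀ be the sum of the generators (interior to
-- M) and G = g a₀. An interior vector a' of M' is g m for some m ∈ M, and
-- some multiple N·a' (N ≥ 1) equals G + g w with w ∈ M. Then a₀ + w and
-- a₀ + m are interior to M, and dividing c by N shows that c·a' + (N-1)·G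
-- lies in g({a₀ + m, a₀ + w, a₀}*) for every c. Summing over a finite set R'
-- of interior vectors of M' yields interior vectors R of M and K ∈ ℕ with
-- y + K·G ∈ g(R*) for all y ∈ R'*. Hence if x + (a₀ ∷ R)* ⊆ X, then
-- f(x + K·a₀) + R'* ⊆ f(X).

open import Defs
import Level
open import Function using (id)
open import Data.Nat as ℕ using (ℕ; zero; suc; s≤s; z≤n; _∸_)
import Data.Nat.Properties as ℕP
open import Data.Nat.DivMod using (_/_; _%_; m≡m%n+[m/n]*n; m%n<n)
open import Data.Integer as ℤ using (ℤ; +_)
import Data.Integer.Properties as ℤP
open import Data.Vec using ([]; _∷_; map)
import Data.Vec.Properties as VecP
open import Data.List as List using (List; []; _∷_; _++_)
open import Data.List.Membership.Propositional using (_∈_)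
open import Data.List.Membership.Propositional.Properties using (∈-map⁺; ∈-map⁻; ∈-++⁺ˡ; ∈-++⁺ʳ)
open import Data.List.Relation.Unary.Any using (here; there)
open import Data.List.Relation.Unary.All as All using (All; []; _∷_)
open import Data.List.Relation.Unary.All.Properties using (++⁺)
open import Data.Product using (∃-syntax; _×_; _,_; proj₁; swap)
open import Relation.Unary using (_⊆_)
open import Relation.Binary.PropositionalEquality
  using (_≡_; refl; sym; trans; cong; cong₂; subst; isEquivalence; module ≡-Reasoning)
open import Algebra.Bundles using (CommutativeMonoid)
open import Algebra.Properties.CommutativeSemigroup ℤP.+-commutativeSemigroup
  using () renaming (interchange to +-interchange)

-- Division with remainder as an identity between ℕ-multiples in a commutative
-- monoid: with N = 1 + N₀, writing k = r + qN (r < N) and N₀ = r + s gives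
--   k·u ∙ N₀·t ≈ r·(u ∙ t) ∙ (q·(N·u) ∙ s·t).
module Division {c ℓ} (M : CommutativeMonoid c ℓ) where
  open CommutativeMonoid M using (Carrier; _≈_; _∙_; ∙-cong; ∙-congʳ; setoid; commutativeSemigroup)
    renaming (sym to ≈-sym)
  open import Algebra.Properties.CommutativeSemigroup commutativeSemigroup using (interchange)
  open import Algebra.Properties.CommutativeMonoid.Mult M
    using (×-congˡ; ×-homo-+; ×-assocˡ; ×-distrib-+) renaming (_×_ to infixr 8 _·_)
  open import Relation.Binary.Reasoning.Setoid setoid

  divide : ∀ (u t : Carrier) (k N₀ : ℕ) →
    ∃[ q ] ∃[ r ] ∃[ s ] (k · u ∙ N₀ · t ≈ r · (u ∙ t) ∙ (q · (suc N₀ · u) ∙ s · t))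
  divide u t k N₀ = q , r , s , (begin
    k · u ∙ N₀ · t                         ≈⟨ ∙-cong (×-congˡ k≡r+qN) (×-congˡ (sym r+s≡N₀)) ⟩
    (r ℕ.+ q ℕ.* N) · u ∙ (r ℕ.+ s) · t    ≈⟨ ∙-cong (×-homo-+ u r (q ℕ.* N)) (×-homo-+ t r s) ⟩
    (r · u ∙ (q ℕ.* N) · u) ∙ (r · t ∙ s · t) ≈⟨ interchange _ _ _ _ ⟩
    (r · u ∙ r · t) ∙ ((q ℕ.* N) · u ∙ s · t) ≈⟨ ∙-cong (≈-sym (×-distrib-+ u t r)) (∙-congʳ (≈-sym (×-assocˡ u q N))) ⟩
    r · (u ∙ t) ∙ (q · (N · u) ∙ s · t)    ∎)
    where
    N q r s : ℕ
    N = suc N₀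
    q = k / N
    r = k % N
    s = N₀ ∸ r
    k≡r+qN : k ≡ r ℕ.+ q ℕ.* N
    k≡r+qN = m≡m%n+[m/n]*n k N
    r+s≡N₀ : r ℕ.+ s ≡ N₀
    r+s≡N₀ = ℕP.m+[n∸m]≡n (ℕP.≤-pred (m%n<n k N))

-- ℤⁿ under componentwise addition is a commutative monoid (with _≡_ as
-- equality), which gives access to the library's monoid lemmas.
ℤ^-commutativeMonoid : ℕ → CommutativeMonoid Level.zero Level.zero
ℤ^-commutativeMonoid n = record
  { Carrier = ℤ^ n
  ; _≈_ = _≡_
  ; _∙_ = _⊕_
  ; ε = 𝟎
  ; isCommutativeMonoid = record
    { isMonoid = record
      { isSemigroup = record
        { isMagma = record { isEquivalence = isEquivalence ; ∙-cong = cong₂ _⊕_ }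
        ; assoc = VecP.zipWith-assoc ℤP.+-assoc }
      ; identity = VecP.zipWith-identityˡ ℤP.+-identityˡ , VecP.zipWith-identityʳ ℤP.+-identityʳ }
    ; comm = VecP.zipWith-comm ℤP.+-comm }
  }

module _ {n : ℕ} where
  open CommutativeMonoid (ℤ^-commutativeMonoid n) public
    using () renaming (assoc to ⊕-assoc; comm to ⊕-comm; identityˡ to ⊕-identityˡ; identityʳ to ⊕-identityʳ)
  open import Algebra.Properties.CommutativeSemigroup
    (CommutativeMonoid.commutativeSemigroup (ℤ^-commutativeMonoid n)) public
    using () renaming (interchange to ⊕-interchange; xy∙z≈zx∙y to ⊕-rotateˡ; x∙yz≈y∙xz to ⊕-swapˡ; x∙yz≈y∙zx to ⊕-rotateʳ)
  open import Algebra.Properties.CommutativeMonoid.Mult (ℤ^-commutativeMonoid n) public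
    using (×-homo-+; ×-distrib-+) renaming (_×_ to infixr 8 _·_)

•-zero : ∀ {n} (x : ℤ^ n) → 0 • x ≡ 𝟎
•-zero [] = refl
•-zero (a ∷ x) = cong₂ _∷_ (ℤP.*-zeroˡ a) (•-zero x)

•-suc : ∀ {n} k (x : ℤ^ n) → suc k • x ≡ x ⊕ k • x
•-suc k [] = refl
•-suc k (a ∷ x) = cong₂ _∷_ (ℤP.suc-* (+ k) a) (•-suc k x)

•≡· : ∀ {n} k (x : ℤ^ n) → k • x ≡ k · x
•≡· zero x = •-zero x
•≡· (suc k) x = trans (•-suc k x) (cong (x ⊕_) (•≡· k x))

lin : ∀ {n n'} → Matrix n' n → ℤ^ n → ℤ^ n'
lin A x = map (λ row → dot row x) A

dot-⊕ : ∀ {n} (r x y : ℤ^ n) → dot r (x ⊕ y) ≡ dot r x ℤ.+ dot r y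
dot-⊕ [] [] [] = refl
dot-⊕ (c ∷ r) (a ∷ x) (b ∷ y) =
  trans (cong₂ ℤ._+_ (ℤP.*-distribˡ-+ c a b) (dot-⊕ r x y))
        (+-interchange (c ℤ.* a) (c ℤ.* b) (dot r x) (dot r y))

dot-𝟎 : ∀ {n} (r : ℤ^ n) → dot r 𝟎 ≡ + 0
dot-𝟎 [] = refl
dot-𝟎 (c ∷ r) = cong₂ ℤ._+_ (ℤP.*-zeroʳ c) (dot-𝟎 r)

lin-⊕ : ∀ {n n'} (A : Matrix n' n) (x y : ℤ^ n) → lin A (x ⊕ y) ≡ lin A x ⊕ lin A y
lin-⊕ [] x y = refl
lin-⊕ (r ∷ A) x y = cong₂ _∷_ (dot-⊕ r x y) (lin-⊕ A x y)

lin-𝟎 : ∀ {n n'} (A : Matrix n' n) → lin A 𝟎 ≡ 𝟎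
lin-𝟎 [] = refl
lin-𝟎 (r ∷ A) = cong₂ _∷_ (dot-𝟎 r) (lin-𝟎 A)

lin-· : ∀ {n n'} (A : Matrix n' n) k (x : ℤ^ n) → lin A (k · x) ≡ k · lin A x
lin-· A zero x = lin-𝟎 A
lin-· A (suc k) x = trans (lin-⊕ A x (k · x)) (cong (lin A x ⊕_) (lin-· A k x))

affine-⊕ : ∀ {n n'} (A : Matrix n' n) (v : ℤ^ n') (x y : ℤ^ n) →
  affine A v (x ⊕ y) ≡ affine A v x ⊕ lin A y
affine-⊕ A v x y = begin
  lin A (x ⊕ y) ⊕ v        ≡⟨ cong (_⊕ v) (lin-⊕ A x y) ⟩
  (lin A x ⊕ lin A y) ⊕ v  ≡⟨ ⊕-assoc _ _ _ ⟩
  lin A x ⊕ (lin A y ⊕ v)  ≡⟨ cong (lin A x ⊕_) (⊕-comm _ _) ⟩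
  lin A x ⊕ (v ⊕ lin A y)  ≡⟨ ⊕-assoc _ _ _ ⟨
  (lin A x ⊕ v) ⊕ lin A y  ∎
  where open ≡-Reasoning

module _ {n : ℕ} {P : List (ℤ^ n)} where

  Gen-⊕ : ∀ {x y} → Gen P x → Gen P y → Gen P (x ⊕ y)
  Gen-⊕ {x} gx gen-zero = subst (Gen P) (sym (⊕-identityʳ x)) gx
  Gen-⊕ {x} gx (gen-step {y} {p} gy p∈P) =
    subst (Gen P) (⊕-assoc x y p) (gen-step (Gen-⊕ gx gy) p∈P)

  Gen-mem : ∀ {p} → p ∈ P → Gen P p
  Gen-mem {p} p∈P = subst (Gen P) (⊕-identityˡ p) (gen-step gen-zero p∈P)

  Gen-· : ∀ {x} k → Gen P x → Gen P (k · x)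
  Gen-· zero gx = gen-zero
  Gen-· (suc k) gx = Gen-⊕ gx (Gen-· k gx)

Gen-mono : ∀ {n} {P Q : List (ℤ^ n)} → (∀ {p} → p ∈ P → p ∈ Q) → Gen P ⊆ Gen Q
Gen-mono P⊆Q gen-zero = gen-zero
Gen-mono P⊆Q (gen-step gx p∈P) = gen-step (Gen-mono P⊆Q gx) (P⊆Q p∈P)

Gen-[] : ∀ {n} {y : ℤ^ n} → Gen [] y → y ≡ 𝟎
Gen-[] gen-zero = refl
Gen-[] (gen-step _ ())

Gen-∷ : ∀ {n} {a : ℤ^ n} {R y} → Gen (a ∷ R) y → ∃[ c ] ∃[ w ] (Gen R w × y ≡ c · a ⊕ w)
Gen-∷ gen-zero = 0 , 𝟎 , gen-zero , sym (⊕-identityˡ 𝟎)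
Gen-∷ {a = a} (gen-step gy (here refl)) with Gen-∷ gy
... | c , w , gw , refl = suc c , w , gw , ⊕-rotateˡ (c · a) w a
Gen-∷ {a = a} (gen-step gy (there p∈R)) with Gen-∷ gy
... | c , w , gw , refl = c , _ , gen-step gw p∈R , ⊕-assoc (c · a) w _

module _ {n n'} (A : Matrix n' n) {P : List (ℤ^ n)} where

  Gen-lin⁺ : ∀ {x} → Gen P x → Gen (List.map (lin A) P) (lin A x)
  Gen-lin⁺ gen-zero = subst (Gen _) (sym (lin-𝟎 A)) gen-zero
  Gen-lin⁺ (gen-step {x} {p} gx p∈P) =
    subst (Gen _) (sym (lin-⊕ A x p)) (gen-step (Gen-lin⁺ gx) (∈-map⁺ (lin A) p∈P))

  Gen-lin⁻ : ∀ {y} → Gen (List.map (lin A) P) y → ∃[ x ] (Gen P x × lin A x ≡ y)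
  Gen-lin⁻ gen-zero = 𝟎 , gen-zero , lin-𝟎 A
  Gen-lin⁻ (gen-step gy q∈AP) with Gen-lin⁻ gy | ∈-map⁻ (lin A) q∈AP
  ... | x , gx , refl | p , p∈P , refl = x ⊕ p , gen-step gx p∈P , lin-⊕ A x p

Interior-≐ : ∀ {n} {M M' : Subset n} {a} → M ≐ M' → Interior M a → Interior M' a
Interior-≐ {M = M} {M'} {a} (M⊆M' , M'⊆M) (Ma , absorbs) = M⊆M' Ma , λ x M'x → absorb (absorbs x (M'⊆M M'x))
  where
  absorb : ∀ {x} → ∃[ N ] (1 ℕ.≤ N × Translate x M (N • a)) → ∃[ N ] (1 ℕ.≤ N × Translate x M' (N • a))
  absorb (N , 1≤N , m , Mm , e) = N , 1≤N , m , M⊆M' Mm , e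

-- The sum σ P of all generators: it absorbs every element of P* and is
-- therefore interior to P*.
module _ {n : ℕ} where

  σ : List (ℤ^ n) → ℤ^ n
  σ [] = 𝟎
  σ (p ∷ P) = p ⊕ σ P

  Gen-σ : ∀ P → Gen P (σ P)
  Gen-σ [] = gen-zero
  Gen-σ (p ∷ P) = Gen-⊕ (Gen-mem (here refl)) (Gen-mono there (Gen-σ P))

  σ-split : ∀ {P p} → p ∈ P → ∃[ rest ] (Gen P rest × σ P ≡ p ⊕ rest)
  σ-split {p ∷ P} (here refl) = σ P , Gen-mono there (Gen-σ P) , refl
  σ-split {q ∷ P} {p} (there p∈P) with σ-split p∈P
  ... | rest , g-rest , e = q ⊕ rest , Gen-⊕ (Gen-mem (here refl)) (Gen-mono there g-rest) ,
        trans (cong (q ⊕_) e) (⊕-swapˡ q p rest)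

  σ-absorbs : ∀ {P x} → Gen P x → ∃[ c ] ∃[ m ] (Gen P m × c · σ P ≡ x ⊕ m)
  σ-absorbs gen-zero = 0 , 𝟎 , gen-zero , sym (⊕-identityˡ 𝟎)
  σ-absorbs {P} (gen-step {x} {p} gx p∈P) with σ-absorbs gx | σ-split p∈P
  ... | c , m , gm , e | rest , g-rest , e' = suc c , rest ⊕ m , Gen-⊕ g-rest gm , (begin
    σ P ⊕ c · σ P          ≡⟨ cong₂ _⊕_ e' e ⟩
    (p ⊕ rest) ⊕ (x ⊕ m)   ≡⟨ ⊕-interchange p rest x m ⟩
    (p ⊕ x) ⊕ (rest ⊕ m)   ≡⟨ cong (_⊕ (rest ⊕ m)) (⊕-comm p x) ⟩
    (x ⊕ p) ⊕ (rest ⊕ m)   ∎)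
    where open ≡-Reasoning

  σ-interior : ∀ P → Interior (Gen P) (σ P)
  σ-interior P = Gen-σ P , λ x gx → absorb (σ-absorbs gx)
    where
    absorb : ∀ {x} → ∃[ c ] ∃[ m ] (Gen P m × c · σ P ≡ x ⊕ m) →
             ∃[ N ] (1 ℕ.≤ N × Translate x (Gen P) (N • σ P))
    absorb {x} (c , m , gm , e) = suc c , s≤s z≤n , m ⊕ σ P , Gen-⊕ gm (Gen-σ P) ,
      trans (•≡· (suc c) (σ P)) (trans (cong (σ P ⊕_) e) (⊕-rotateʳ (σ P) x m))

  interior-⊕ : ∀ {P : List (ℤ^ n)} {a m} → Interior (Gen P) a → Gen P m → Interior (Gen P) (a ⊕ m)
  interior-⊕ {P} {a} {m} (ga , absorbs) gm = Gen-⊕ ga gm , λ x gx → absorb (absorbs x gx)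
    where
    absorb : ∀ {x} → ∃[ N ] (1 ℕ.≤ N × Translate x (Gen P) (N • a)) →
             ∃[ N ] (1 ℕ.≤ N × Translate x (Gen P) (N • (a ⊕ m)))
    absorb {x} (N , 1≤N , m' , gm' , e) = N , 1≤N , m' ⊕ N · m , Gen-⊕ gm' (Gen-· N gm) , (begin
      N • (a ⊕ m)          ≡⟨ •≡· N (a ⊕ m) ⟩
      N · (a ⊕ m)          ≡⟨ ×-distrib-+ a m N ⟩
      N · a ⊕ N · m        ≡⟨ cong (_⊕ N · m) (trans (sym (•≡· N a)) e) ⟩
      (x ⊕ m') ⊕ N · m     ≡⟨ ⊕-assoc x m' (N · m) ⟩
      x ⊕ (m' ⊕ N · m)     ∎)
      where open ≡-Reasoning

-- With a₀ = σ P and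
-- G = g a₀, a vector y of g(P*) is "lifted by (R, K)" when y ⊕ K·G lies in
-- g(R*); interior vectors of g(P*) are lifted by interior vectors of P*.
module Lifting {n n'} (A : Matrix n' n) (P : List (ℤ^ n)) where
  open Division (ℤ^-commutativeMonoid n') using (divide)

  g : ℤ^ n → ℤ^ n'
  g = lin A

  a₀ : ℤ^ n
  a₀ = σ P

  G : ℤ^ n'
  G = g a₀

  Lifts : List (ℤ^ n) → ℕ → ℤ^ n' → Set
  Lifts R K y = ∃[ z ] (Gen R z × g z ≡ y ⊕ K · G)

  lifts-⊕ : ∀ {R R' K K' y y'} → Lifts R K y → Lifts R' K' y' → Lifts (R ++ R') (K ℕ.+ K') (y ⊕ y')
  lifts-⊕ {R} {R'} {K} {K'} {y} {y'} (z , gz , e) (z' , gz' , e') =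
    z ⊕ z' , Gen-⊕ (Gen-mono ∈-++⁺ˡ gz) (Gen-mono (∈-++⁺ʳ R) gz') , (begin
      g (z ⊕ z')                    ≡⟨ lin-⊕ A z z' ⟩
      g z ⊕ g z'                    ≡⟨ cong₂ _⊕_ e e' ⟩
      (y ⊕ K · G) ⊕ (y' ⊕ K' · G)   ≡⟨ ⊕-interchange y (K · G) y' (K' · G) ⟩
      (y ⊕ y') ⊕ (K · G ⊕ K' · G)   ≡⟨ cong ((y ⊕ y') ⊕_) (sym (×-homo-+ G K K')) ⟩
      (y ⊕ y') ⊕ (K ℕ.+ K') · G     ∎)
    where open ≡-Reasoning

  lift-multiples : ∀ {a'} → Interior (Gen (List.map g P)) a' →
    ∃[ R ] (All (Interior (Gen P)) R × ∃[ K ] (∀ k → Lifts R K (k · a')))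
  lift-multiples (ga' , absorbs) with Gen-lin⁻ A ga' | absorbs G (Gen-lin⁺ A (Gen-σ P))
  ... | m , gm , refl | suc N₀ , s≤s z≤n , _ , gm' , N•a'≡G⊕m' with Gen-lin⁻ A gm'
  ... | w , gw , refl =
    eᵢ ∷ aᵢ ∷ a₀ ∷ [] ,
    interior-⊕ (σ-interior P) gm ∷ interior-⊕ (σ-interior P) gw ∷ σ-interior P ∷ [] ,
    N₀ , lift
    where
    eᵢ aᵢ : ℤ^ n
    eᵢ = a₀ ⊕ m
    aᵢ = a₀ ⊕ w

    g-eᵢ : g eᵢ ≡ g m ⊕ G
    g-eᵢ = trans (lin-⊕ A a₀ m) (⊕-comm G (g m))

    g-aᵢ : g aᵢ ≡ suc N₀ · g m
    g-aᵢ = trans (lin-⊕ A a₀ w) (trans (sym N•a'≡G⊕m') (•≡· (suc N₀) (g m)))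

    g-combination : ∀ r q s x y z → g (r · x ⊕ (q · y ⊕ s · z)) ≡ r · g x ⊕ (q · g y ⊕ s · g z)
    g-combination r q s x y z = trans (lin-⊕ A _ _)
      (cong₂ _⊕_ (lin-· A r x) (trans (lin-⊕ A _ _) (cong₂ _⊕_ (lin-· A q y) (lin-· A s z))))

    lift : ∀ k → Lifts (eᵢ ∷ aᵢ ∷ a₀ ∷ []) N₀ (k · g m)
    lift k with divide (g m) G k N₀
    ... | q , r , s , division =
      r · eᵢ ⊕ (q · aᵢ ⊕ s · a₀) ,
      Gen-⊕ (Gen-· r (Gen-mem (here refl)))
            (Gen-⊕ (Gen-· q (Gen-mem (there (here refl)))) (Gen-· s (Gen-mem (there (there (here refl)))))) ,
      (begin
        g (r · eᵢ ⊕ (q · aᵢ ⊕ s · a₀))               ≡⟨ g-combination r q s eᵢ aᵢ a₀ ⟩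
        r · g eᵢ ⊕ (q · g aᵢ ⊕ s · G)                ≡⟨ cong₂ (λ e a → r · e ⊕ (q · a ⊕ s · G)) g-eᵢ g-aᵢ ⟩
        r · (g m ⊕ G) ⊕ (q · (suc N₀ · g m) ⊕ s · G) ≡⟨ sym division ⟩
        k · g m ⊕ N₀ · G                             ∎)
      where open ≡-Reasoning

  lift-generated : ∀ {R'} → All (Interior (Gen (List.map g P))) R' →
    ∃[ R ] (All (Interior (Gen P)) R × ∃[ K ] (∀ y → Gen R' y → Lifts R K y))
  lift-generated [] = [] , [] , 0 , λ y gy → 𝟎 , gen-zero ,
    trans (lin-𝟎 A) (trans (sym (⊕-identityʳ 𝟎)) (cong (_⊕ 𝟎) (sym (Gen-[] gy))))
  lift-generated {a' ∷ R''} (int ∷ ints) with lift-multiples int | lift-generated ints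
  ... | Rₐ , intsₐ , Kₐ , liftₐ | R₁ , ints₁ , K₁ , lift₁ = Rₐ ++ R₁ , ++⁺ intsₐ ints₁ , Kₐ ℕ.+ K₁ , lift
    where
    lift : ∀ y → Gen (a' ∷ R'') y → Lifts (Rₐ ++ R₁) (Kₐ ℕ.+ K₁) y
    lift y gy with Gen-∷ gy
    ... | c , w , gw , refl = lifts-⊕ {K = Kₐ} {K₁} (liftₐ c) (lift₁ w gw)

Image-mono : ∀ {n n'} (f : ℤ^ n → ℤ^ n') {X Y : Subset n} → X ⊆ Y → Image f X ⊆ Image f Y
Image-mono f X⊆Y (x , Xx , fx≡y) = x , X⊆Y Xx , fx≡y

Image-≐ : ∀ {n n'} (f : ℤ^ n → ℤ^ n') {X Y : Subset n} → X ≐ Y → Image f X ≐ Image f Y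
Image-≐ f (X⊆Y , Y⊆X) = Image-mono f X⊆Y , Image-mono f Y⊆X

≐-trans : ∀ {n} {X Y Z : Subset n} → X ≐ Y → Y ≐ Z → X ≐ Z
≐-trans (X⊆Y , Y⊆X) (Y⊆Z , Z⊆Y) = (λ Xx → Y⊆Z (X⊆Y Xx)) , (λ Zx → Y⊆X (Z⊆Y Zx))

module AffineImage {n n'} (A : Matrix n' n) (v : ℤ^ n') where

  f : ℤ^ n → ℤ^ n'
  f = affine A v

  image-translate : ∀ {b : ℤ^ n} {M P} → M ≐ Gen P →
    Image f (Translate b M) ≐ Translate (f b) (Gen (List.map (lin A) P))
  image-translate {b} {M} {P} (M⊆P* , P*⊆M) = forward , backward
    where
    forward : Image f (Translate b M) ⊆ Translate (f b) (Gen (List.map (lin A) P))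
    forward (x , (m , Mm , refl) , refl) = lin A m , Gen-lin⁺ A (M⊆P* Mm) , affine-⊕ A v b m

    backward : Translate (f b) (Gen (List.map (lin A) P)) ⊆ Image f (Translate b M)
    backward (_ , gAP , refl) with Gen-lin⁻ A gAP
    ... | w , gw , refl = b ⊕ w , (w , P*⊆M gw , refl) , affine-⊕ A v b w

  image-linearizator : ∀ {X b M} {P : List (ℤ^ n)} → M ≐ Gen P → IsLinearizatorAt X b M →
    IsLinearizatorAt (Image f X) (f b) (Gen (List.map (lin A) P))
  image-linearizator {X} {b} {M} {P} M≐P* (_ , X⊆b+M , pumps) =
    (List.map g P , id , id) ,
    (λ fXy → proj₁ (image-translate M≐P*) (Image-mono f X⊆b+M fXy)) ,
    image-pumps
    where
    open Lifting A P

    image-pumps : ∀ (R' : List (ℤ^ n')) → All (Interior (Gen (List.map g P))) R' →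
      ∃[ x' ] (Image f X x' × (∀ y → Gen R' y → Image f X (x' ⊕ y)))
    image-pumps R' ints' with lift-generated ints'
    ... | R , ints , K , lifts with pumps (a₀ ∷ R) (All.map (Interior-≐ (swap M≐P*)) (σ-interior P ∷ ints))
    ... | x , _ , x+R*⊆X =
      f (x ⊕ K · a₀) , (x ⊕ K · a₀ , x+R*⊆X _ (Gen-· K (Gen-mem (here refl))) , refl) , shifted
      where
      shifted : ∀ y → Gen R' y → Image f X (f (x ⊕ K · a₀) ⊕ y)
      shifted y gy with lifts y gy
      ... | z , gz , gz≡y⊕KG = x ⊕ z , x+R*⊆X z (Gen-mono there gz) , (begin
        f (x ⊕ z)               ≡⟨ affine-⊕ A v x z ⟩
        f x ⊕ g z               ≡⟨ cong (f x ⊕_) (trans gz≡y⊕KG (⊕-comm y (K · G))) ⟩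
        f x ⊕ (K · G ⊕ y)       ≡⟨ ⊕-assoc (f x) (K · G) y ⟨
        (f x ⊕ K · G) ⊕ y       ≡⟨ cong (λ t → (f x ⊕ t) ⊕ y) (lin-· A K a₀) ⟨
        (f x ⊕ g (K · a₀)) ⊕ y  ≡⟨ cong (_⊕ y) (affine-⊕ A v x (K · a₀)) ⟨
        f (x ⊕ K · a₀) ⊕ y      ∎)
        where open ≡-Reasoning

proposition4p6 : ∀ (n n' : ℕ) (A : Matrix n' n) (v : ℤ^ n') (X : Subset n) →
    PseudoLinear X →
    PseudoLinear (Image (affine A v) X) ×
    (∀ (L : Subset n) → IsLinearization X L →
       IsLinearization (Image (affine A v) X) (Image (affine A v) L))
proposition4p6 n n' A v X (b , M , isLin@((P , M≐P*) , _)) =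
  (f b , Gen (List.map (lin A) P) , image-linearizator M≐P* isLin) , image-linearization
  where
  open AffineImage A v

  image-linearization : ∀ (L : Subset n) → IsLinearization X L → IsLinearization (Image f X) (Image f L)
  image-linearization L (b' , M' , isLin'@((P' , M'≐P'*) , _) , L≐b'+M') =
    f b' , Gen (List.map (lin A) P') , image-linearizator M'≐P'* isLin' ,
    ≐-trans (Image-≐ f L≐b'+M') (image-translate M'≐P'*)
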